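{- Let $\mathbf{A}$ be a residuated lattice. If $\Delta$ exists in $\mathbf{A}$, then $B$ also exists in $\mathbf{A}$ and $B=\Delta$; that is, for every $a\in A$, $\Delta a$ is the greatest element $b\le a$ with $b\vee\neg b=1$.
   Context: A residuated lattice is an algebra $(A;\wedge,\vee,\cdot,\to,0,1)$ with $(A;\wedge,\vee,0,1)$ a bounded lattice ($0$ least, $1$ greatest), $(A;\cdot,1)$ a commutative monoid, and $a\cdot b\le c$ iff $a\le b\to c$; $\neg a=a\to0$. "$\Delta$ exists in $\mathbf{A}$" means there is a unary operation $\Delta$ on $A$ satisfying, for all $x,y\in A$: $\Delta x\le x$; $\Delta x\vee\neg\Delta x=1$; $\Delta(x\vee y)\le\Delta x\vee\Delta y$; $\Delta1=1$; $\Delta x\le\Delta\Delta x$; $\Delta(x\to y)\le\Delta x\to\Delta y$. -}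

module Defs where

open import Level using (Level; suc; _⊔_)
open import Relation.Binary.PropositionalEquality using (_≡_)
open import Algebra.Lattice.Structures using (IsLattice)
open import Algebra.Structures using (IsCommutativeMonoid)
open import Data.Product using (_×_)

record ResiduatedLattice (a : Level) : Set (suc a) where
  infixr 6 _∨_
  infixr 7 _∧_
  infixl 8 _·_
  infixr 5 _⇒_
  infix 4 _≤_
  field
    Carrier : Set a
    _∧_ _∨_ _·_ _⇒_ : Carrier → Carrier → Carrier
    𝟘 𝟙 : Carrier
    isLattice : IsLattice _≡_ _∨_ _∧_

  _≤_ : Carrier → Carrier → Set a
  x ≤ y = x ∧ y ≡ x

  field
    bottom : ∀ x → 𝟘 ≤ x
    top    : ∀ x → x ≤ 𝟙
    isCommutativeMonoid : IsCommutativeMonoid _≡_ _·_ 𝟙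
    residuation₁ : ∀ x y z → x · y ≤ z → x ≤ y ⇒ z
    residuation₂ : ∀ x y z → x ≤ y ⇒ z → x · y ≤ z

  ¬_ : Carrier → Carrier
  ¬ x = x ⇒ 𝟘

record IsDelta {a : Level} (L : ResiduatedLattice a)
               (Δ : ResiduatedLattice.Carrier L → ResiduatedLattice.Carrier L) : Set a where
  open ResiduatedLattice L
  field
    Δ-deflationary : ∀ x → Δ x ≤ x
    Δ-complemented : ∀ x → Δ x ∨ (¬ Δ x) ≡ 𝟙
    Δ-∨            : ∀ x y → Δ (x ∨ y) ≤ Δ x ∨ Δ y
    Δ-𝟙            : Δ 𝟙 ≡ 𝟙
    Δ-idem         : ∀ x → Δ x ≤ Δ (Δ x)
    Δ-⇒            : ∀ x y → Δ (x ⇒ y) ≤ Δ x ⇒ Δ y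

IsGreatestComplementedBelow : {a : Level} (L : ResiduatedLattice a) →
  (ResiduatedLattice.Carrier L → ResiduatedLattice.Carrier L) → Set a
IsGreatestComplementedBelow L f = ∀ x →
    (f x ≤ x × f x ∨ (¬ f x) ≡ 𝟙)
  × (∀ b → b ≤ x → b ∨ (¬ b) ≡ 𝟙 → b ≤ f x)
  where open ResiduatedLattice L

-- Δ is monotone: x ≤ y gives x ⇒ y = 1, hence 1 = Δ(x ⇒ y) ≤ Δx ⇒ Δy, i.e.
-- Δx ≤ Δy.  A complemented b lies below Δb: 1 = Δ(b ∨ ¬b) ≤ Δb ∨ Δ¬b, and both
-- joinands lie below b ⇒ Δb (the first by integrality, the second because
-- Δ¬b ≤ ¬b), so b ≤ Δb.  Hence a complemented b ≤ x satisfies b ≤ Δb ≤ Δx,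
-- while Δx itself is complemented and below x.
module Submission where

open import Defs
open import Level using (Level)
open import Data.Product using (_,_)
open import Relation.Binary.PropositionalEquality using (_≡_; sym; trans; cong; subst; subst₂)
open import Algebra.Lattice.Bundles using (Lattice)
import Algebra.Lattice.Properties.Lattice as LatticeProperties
import Relation.Binary.Lattice.Bundles as OrderTheoretic
open import Algebra.Structures using (IsCommutativeMonoid)

module ResiduatedLatticeProperties {a : Level} (L : ResiduatedLattice a) where
  open ResiduatedLattice L
  open IsCommutativeMonoid isCommutativeMonoid using (identityˡ; comm)

  lattice : Lattice a a
  lattice = record { isLattice = isLattice }

  -- The library orders a lattice by x ≡ x ∧ y, the symmetric form of _≤_.
  open OrderTheoretic.Lattice (LatticeProperties.∨-∧-orderTheoreticLattice lattice)
    using () renaming (refl to ≼-refl; trans to ≼-trans; antisym to ≼-antisym; ∨-least to ≼-∨-least)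

  ≤-refl : ∀ {x} → x ≤ x
  ≤-refl = sym ≼-refl

  ≤-trans : ∀ {x y z} → x ≤ y → y ≤ z → x ≤ z
  ≤-trans x≤y y≤z = sym (≼-trans (sym x≤y) (sym y≤z))

  ≤-antisym : ∀ {x y} → x ≤ y → y ≤ x → x ≡ y
  ≤-antisym x≤y y≤x = ≼-antisym (sym x≤y) (sym y≤x)

  ∨-least : ∀ {x y z} → x ≤ z → y ≤ z → x ∨ y ≤ z
  ∨-least x≤z y≤z = sym (≼-∨-least (sym x≤z) (sym y≤z))

  ≤⇒𝟙≤⇒ : ∀ {x y} → x ≤ y → 𝟙 ≤ x ⇒ y
  ≤⇒𝟙≤⇒ {x} {y} x≤y = residuation₁ 𝟙 x y (subst (_≤ y) (sym (identityˡ x)) x≤y)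

  𝟙≤⇒⇒≤ : ∀ {x y} → 𝟙 ≤ x ⇒ y → x ≤ y
  𝟙≤⇒⇒≤ {x} {y} 𝟙≤x⇒y = subst (_≤ y) (identityˡ x) (residuation₂ 𝟙 x y 𝟙≤x⇒y)

  ≤⇒⇒≡𝟙 : ∀ {x y} → x ≤ y → x ⇒ y ≡ 𝟙
  ≤⇒⇒≡𝟙 x≤y = ≤-antisym (top _) (≤⇒𝟙≤⇒ x≤y)

  ·-monoˡ-≤ : ∀ {x y} z → x ≤ y → x · z ≤ y · z
  ·-monoˡ-≤ {x} {y} z x≤y =
    residuation₂ x z (y · z) (≤-trans x≤y (residuation₁ y z (y · z) ≤-refl))

  x·y≤x : ∀ x y → x · y ≤ x
  x·y≤x x y = subst₂ _≤_ (comm y x) (identityˡ x) (·-monoˡ-≤ x (top y))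

  y≤x⇒y : ∀ x y → y ≤ x ⇒ y
  y≤x⇒y x y = residuation₁ y x y (x·y≤x y x)

  ¬x≤x⇒y : ∀ x y → ¬ x ≤ x ⇒ y
  ¬x≤x⇒y x y = residuation₁ (¬ x) x y (≤-trans (residuation₂ (¬ x) x 𝟘 ≤-refl) (bottom y))

module DeltaProperties {a : Level} (L : ResiduatedLattice a)
    {Δ : ResiduatedLattice.Carrier L → ResiduatedLattice.Carrier L}
    (isDelta : IsDelta L Δ) where
  open ResiduatedLattice L
  open IsDelta isDelta
  open ResiduatedLatticeProperties L

  Δ-mono : ∀ {x y} → x ≤ y → Δ x ≤ Δ y
  Δ-mono {x} {y} x≤y =
    𝟙≤⇒⇒≤ (subst (_≤ Δ x ⇒ Δ y) Δ[x⇒y]≡𝟙 (Δ-⇒ x y))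
    where
      Δ[x⇒y]≡𝟙 : Δ (x ⇒ y) ≡ 𝟙
      Δ[x⇒y]≡𝟙 = trans (cong Δ (≤⇒⇒≡𝟙 x≤y)) Δ-𝟙

  complemented⇒≤Δ : ∀ {b} → b ∨ ¬ b ≡ 𝟙 → b ≤ Δ b
  complemented⇒≤Δ {b} b∨¬b≡𝟙 = 𝟙≤⇒⇒≤ (≤-trans 𝟙≤Δb∨Δ¬b (∨-least Δb≤b⇒Δb Δ¬b≤b⇒Δb))
    where
      𝟙≤Δb∨Δ¬b : 𝟙 ≤ Δ b ∨ Δ (¬ b)
      𝟙≤Δb∨Δ¬b = subst (_≤ Δ b ∨ Δ (¬ b)) (trans (cong Δ b∨¬b≡𝟙) Δ-𝟙) (Δ-∨ b (¬ b))

      Δb≤b⇒Δb : Δ b ≤ b ⇒ Δ b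
      Δb≤b⇒Δb = y≤x⇒y b (Δ b)

      Δ¬b≤b⇒Δb : Δ (¬ b) ≤ b ⇒ Δ b
      Δ¬b≤b⇒Δb = ≤-trans (Δ-deflationary (¬ b)) (¬x≤x⇒y b (Δ b))

proposition14 : {a : Level} (L : ResiduatedLattice a)
    (Δ : ResiduatedLattice.Carrier L → ResiduatedLattice.Carrier L) →
    IsDelta L Δ → IsGreatestComplementedBelow L Δ
proposition14 L Δ isDelta x =
    (Δ-deflationary x , Δ-complemented x)
  , λ b b≤x b∨¬b≡𝟙 → ≤-trans (complemented⇒≤Δ b∨¬b≡𝟙) (Δ-mono b≤x)
  where
    open IsDelta isDelta
    open ResiduatedLatticeProperties L using (≤-trans)
    open DeltaProperties L isDelta
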